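{- If $\Gamma$ is a graph with property R, then $\Gamma$ has no full (induced) subgraph isomorphic to either of the following two graphs: (a) the complete graph $K_4$ with one edge removed (vertices $1,2,3,4$, all pairs adjacent except $1$ and $3$); (b) a triangle on vertices $6,7,8$ together with a vertex $5$ adjacent only to $6$.
   Context: For a set $P$ with a symmetric reflexive relation $\mathcal{C}$: a labelled heap is $(E,\le,\varepsilon)$ with $(E,\le)$ a finite poset, $\varepsilon:E\to P$, such that elements with $\varepsilon(a)\,\mathcal{C}\,\varepsilon(b)$ are comparable and $\le$ is the transitive closure of "$a\le b$ and $\varepsilon(a)\,\mathcal{C}\,\varepsilon(b)$"; heaps are label-preserving isomorphism classes, forming $H(P,\mathcal{C})$. $E(v)$ is the subheap on $E\setminus\{v\}$ (order: transitive closure of the same relation restricted). Trivial heap: trivial order. Convex chain: chain $x_1<\dots<x_t$ containing every $y$ with $x_i<y<x_j$; length $t$; balanced if $\varepsilon(x_1)=\varepsilon(x_t)$. Property P2: no balanced convex chain of length 2 or 3. $E(a)\prec^+E$ if $a$ is maximal in $E$ and some element maximal in $E(a)$ but not in $E$ has label $\ne\varepsilon(a)$; $\prec^-$ likewise with minimal elements; $\prec$ means either. Property P1: there is a (possibly trivial) sequence $E_1\prec\cdots\prec E$ with $E_1$ trivial. The concurrency graph of $H(P,\mathcal{C})$ has vertices $P$ and edges between distinct $v,w$ with $v\,\mathcal{C}\,w$. A graph has property R if it is the concurrency graph of a class of heaps in which every heap with property P2 has property P1. -}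

module Defs where

open import Data.Nat using (ℕ; zero; suc)
open import Data.Fin using (Fin; zero; suc; punchIn; fromℕ) renaming (_<_ to _<ᶠ_)
open import Data.Bool using (Bool; true; false; T)
open import Data.Product using (Σ; _×_; _,_; ∃)
open import Data.Sum using (_⊎_)
open import Data.Empty using (⊥)
open import Function using (_⇔_)
open import Function.Definitions using (Injective)
open import Relation.Nullary using (¬_)
open import Relation.Binary.PropositionalEquality using (_≡_; _≢_; refl)
open import Relation.Binary.Structures using (IsPartialOrder)
open import Relation.Binary.Construct.Closure.ReflexiveTransitive using (Star)

record Graph : Set₁ where
  field
    V      : Set
    Adj    : V → V → Set
    sym    : ∀ {u v} → Adj u v → Adj v u
    irrefl : ∀ {v} → ¬ Adj v v

open Graph public

HasInducedCopy : Graph → Graph → Set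
HasInducedCopy G H =
  Σ (V H → V G) λ f → Injective _≡_ _≡_ f × (∀ u v → Adj H u v ⇔ Adj G (f u) (f v))

-- Heaps over (P , 𝒞), 𝒞 symmetric and reflexive.
-- A labelled heap with n elements is carried by Fin n.

record RawHeap (P : Set) (n : ℕ) : Set₁ where
  field
    ε   : Fin n → P
    _≤_ : Fin n → Fin n → Set

open RawHeap public

module HeapTheory {P : Set} (𝒞 : P → P → Set) where

  Gen : ∀ {n} → RawHeap P n → Fin n → Fin n → Set
  Gen E a b = _≤_ E a b × 𝒞 (ε E a) (ε E b)

  record IsHeap {n} (E : RawHeap P n) : Set where
    field
      isPartialOrder : IsPartialOrder _≡_ (_≤_ E)
      comparable     : ∀ a b → 𝒞 (ε E a) (ε E b) → _≤_ E a b ⊎ _≤_ E b a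
      generated      : ∀ a b → _≤_ E a b → Star (Gen E) a b

  _<_∶_ : ∀ {n} → RawHeap P n → Fin n → Fin n → Set
  E < a ∶ b = _≤_ E a b × a ≢ b

  delete : ∀ {m} → RawHeap P (suc m) → Fin (suc m) → RawHeap P m
  delete E v = record
    { ε   = λ x → ε E (punchIn v x)
    ; _≤_ = Star (λ x y → Gen E (punchIn v x) (punchIn v y))
    }

  Trivial : ∀ {n} → RawHeap P n → Set
  Trivial E = ∀ a b → _≤_ E a b → a ≡ b

  Maximal : ∀ {n} → RawHeap P n → Fin n → Set
  Maximal E a = ∀ b → _≤_ E a b → b ≡ a

  Minimal : ∀ {n} → RawHeap P n → Fin n → Set
  Minimal E a = ∀ b → _≤_ E b a → b ≡ a

  Prec⁺ : ∀ {m} → RawHeap P (suc m) → Fin (suc m) → Set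
  Prec⁺ E a = Maximal E a × ∃ λ b →
    Maximal (delete E a) b × ¬ Maximal E (punchIn a b) × ε E (punchIn a b) ≢ ε E a

  Prec⁻ : ∀ {m} → RawHeap P (suc m) → Fin (suc m) → Set
  Prec⁻ E a = Minimal E a × ∃ λ b →
    Minimal (delete E a) b × ¬ Minimal E (punchIn a b) × ε E (punchIn a b) ≢ ε E a

  Prec : ∀ {m} → RawHeap P (suc m) → Fin (suc m) → Set
  Prec E a = Prec⁺ E a ⊎ Prec⁻ E a

  -- Property P1: a (possibly trivial) sequence E₁ ≺ ⋯ ≺ E with E₁ trivial
  P1 : ∀ {n} → RawHeap P n → Set
  P1 {zero}  E = Trivial E
  P1 {suc m} E = Trivial E ⊎ ∃ λ a → Prec E a × P1 (delete E a)

  IsConvexChain : ∀ {n t} → RawHeap P n → (Fin t → Fin n) → Set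
  IsConvexChain {t = t} E x =
    (∀ i j → i <ᶠ j → E < x i ∶ x j) ×
    (∀ i j y → E < x i ∶ y → E < y ∶ x j → ∃ λ k → y ≡ x k)

  Balanced : ∀ {n k} → RawHeap P n → (Fin (suc k) → Fin n) → Set
  Balanced {k = k} E x = ε E (x zero) ≡ ε E (x (fromℕ k))

  P2 : ∀ {n} → RawHeap P n → Set
  P2 E = (∀ (x : Fin 2 → _) → IsConvexChain E x → ¬ Balanced E x)
       × (∀ (x : Fin 3 → _) → IsConvexChain E x → ¬ Balanced E x)

-- Γ has property R: Γ is the concurrency graph of H(P,𝒞) with P = V Γ and
-- 𝒞 the reflexive closure of adjacency, and every heap with P2 has P1.
ConcRel : (Γ : Graph) → V Γ → V Γ → Set
ConcRel Γ v w = v ≡ w ⊎ Adj Γ v w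

PropertyR : Graph → Set₁
PropertyR Γ = ∀ {n} (E : RawHeap (V Γ) n) → IsHeap E → P2 E → P1 E
  where open HeapTheory (ConcRel Γ)

-- (a) K₄ minus an edge: vertices 1,2,3,4 ↦ 0,1,2,3; only 1,3 (0,2) non-adjacent
k4e : Fin 4 → Fin 4 → Bool
k4e zero zero = false
k4e zero (suc zero) = true
k4e zero (suc (suc zero)) = false
k4e zero (suc (suc (suc zero))) = true
k4e (suc zero) zero = true
k4e (suc zero) (suc zero) = false
k4e (suc zero) (suc (suc zero)) = true
k4e (suc zero) (suc (suc (suc zero))) = true
k4e (suc (suc zero)) zero = false
k4e (suc (suc zero)) (suc zero) = true
k4e (suc (suc zero)) (suc (suc zero)) = false
k4e (suc (suc zero)) (suc (suc (suc zero))) = true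
k4e (suc (suc (suc zero))) zero = true
k4e (suc (suc (suc zero))) (suc zero) = true
k4e (suc (suc (suc zero))) (suc (suc zero)) = true
k4e (suc (suc (suc zero))) (suc (suc (suc zero))) = false

-- (b) triangle 6,7,8 plus vertex 5 adjacent only to 6: 5,6,7,8 ↦ 0,1,2,3
paw : Fin 4 → Fin 4 → Bool
paw zero zero = false
paw zero (suc zero) = true
paw zero (suc (suc zero)) = false
paw zero (suc (suc (suc zero))) = false
paw (suc zero) zero = true
paw (suc zero) (suc zero) = false
paw (suc zero) (suc (suc zero)) = true
paw (suc zero) (suc (suc (suc zero))) = true
paw (suc (suc zero)) zero = false
paw (suc (suc zero)) (suc zero) = true
paw (suc (suc zero)) (suc (suc zero)) = false
paw (suc (suc zero)) (suc (suc (suc zero))) = true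
paw (suc (suc (suc zero))) zero = false
paw (suc (suc (suc zero))) (suc zero) = true
paw (suc (suc (suc zero))) (suc (suc zero)) = true
paw (suc (suc (suc zero))) (suc (suc (suc zero))) = false

k4e-sym : ∀ {i j} → T (k4e i j) → T (k4e j i)
k4e-sym {zero} {suc zero} t = t
k4e-sym {zero} {suc (suc (suc zero))} t = t
k4e-sym {suc zero} {zero} t = t
k4e-sym {suc zero} {suc (suc zero)} t = t
k4e-sym {suc zero} {suc (suc (suc zero))} t = t
k4e-sym {suc (suc zero)} {suc zero} t = t
k4e-sym {suc (suc zero)} {suc (suc (suc zero))} t = t
k4e-sym {suc (suc (suc zero))} {zero} t = t
k4e-sym {suc (suc (suc zero))} {suc zero} t = t
k4e-sym {suc (suc (suc zero))} {suc (suc zero)} t = t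
k4e-sym {zero} {zero} ()
k4e-sym {zero} {suc (suc zero)} ()
k4e-sym {suc zero} {suc zero} ()
k4e-sym {suc (suc zero)} {zero} ()
k4e-sym {suc (suc zero)} {suc (suc zero)} ()
k4e-sym {suc (suc (suc zero))} {suc (suc (suc zero))} ()

k4e-irrefl : ∀ {i} → ¬ T (k4e i i)
k4e-irrefl {zero} ()
k4e-irrefl {suc zero} ()
k4e-irrefl {suc (suc zero)} ()
k4e-irrefl {suc (suc (suc zero))} ()

paw-sym : ∀ {i j} → T (paw i j) → T (paw j i)
paw-sym {zero} {suc zero} t = t
paw-sym {suc zero} {zero} t = t
paw-sym {suc zero} {suc (suc zero)} t = t
paw-sym {suc zero} {suc (suc (suc zero))} t = t
paw-sym {suc (suc zero)} {suc zero} t = t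
paw-sym {suc (suc zero)} {suc (suc (suc zero))} t = t
paw-sym {suc (suc (suc zero))} {suc zero} t = t
paw-sym {suc (suc (suc zero))} {suc (suc zero)} t = t
paw-sym {zero} {zero} ()
paw-sym {zero} {suc (suc zero)} ()
paw-sym {zero} {suc (suc (suc zero))} ()
paw-sym {suc zero} {suc zero} ()
paw-sym {suc (suc zero)} {zero} ()
paw-sym {suc (suc zero)} {suc (suc zero)} ()
paw-sym {suc (suc (suc zero))} {zero} ()
paw-sym {suc (suc (suc zero))} {suc (suc (suc zero))} ()

paw-irrefl : ∀ {i} → ¬ T (paw i i)
paw-irrefl {zero} ()
paw-irrefl {suc zero} ()
paw-irrefl {suc (suc zero)} ()
paw-irrefl {suc (suc (suc zero))} ()

K4minusEdge : Graph
K4minusEdge = record { V = Fin 4 ; Adj = λ i j → T (k4e i j) ; sym = k4e-sym ; irrefl = k4e-irrefl }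

Paw : Graph
Paw = record { V = Fin 4 ; Adj = λ i j → T (paw i j) ; sym = paw-sym ; irrefl = paw-irrefl }

-- For each forbidden graph H we exhibit a heap over the vertices of H that has
-- P2 but not P1, and transport it to Γ along the induced copy, which preserves
-- both concurrency and equality of labels. The heap is layered (a < b iff b
-- lies in a higher layer), with top and bottom layers consisting of two
-- non-adjacent vertices. Deleting any element exposes no new maximal or minimal
-- element, so no step E(a) ≺ E exists although the heap is not trivial; and
-- equal labels always lie at least three layers apart, so every balanced convex
-- chain has length at least four. These conditions only involve the finite
-- graph H, so they are decided by evaluation.
module Submission where

open import Defs
open import Data.Empty using (⊥-elim)
open import Data.Fin using (Fin; zero; suc; punchIn; #_; _≟_)
open import Data.Fin.Properties using (all?; any?)
open import Data.Nat using (ℕ; zero; suc; _<_; _<?_; s≤s; z≤n)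
open import Data.Nat.Properties using (<-trans; <-asym)
open import Data.Product using (_×_; _,_; proj₁; proj₂; ∃)
open import Data.Sum using (_⊎_; inj₁; inj₂)
import Data.Sum as Sum
open import Data.Vec using ([]; _∷_; lookup)
open import Function using (_∘_; _⇔_; Equivalence)
open import Function.Definitions using (Injective)
open import Relation.Binary.Definitions using (Decidable; DecidableEquality)
open import Relation.Binary.Structures using (IsPartialOrder)
open import Relation.Binary.PropositionalEquality using (_≡_; _≢_; refl; cong; isEquivalence)
import Relation.Binary.PropositionalEquality as ≡
open import Relation.Binary.Construct.Closure.ReflexiveTransitive using (Star; _◅_)
  renaming (ε to ε⋆)
open import Relation.Nullary using (¬_; Dec)
open import Relation.Nullary.Decidable
  using (True; toWitness; map′; ¬?; _×-dec_; _⊎-dec_; _→-dec_; T?)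

Within : {A : Set} → ℕ → (A → A → Set) → A → A → Set
Within zero    R a b = a ≡ b
Within (suc k) R a b = a ≡ b ⊎ ∃ λ c → R a c × Within k R c b

within⇒star : ∀ {A : Set} {R : A → A → Set} k {a b} → Within k R a b → Star R a b
within⇒star zero    refl                = ε⋆
within⇒star (suc k) (inj₁ refl)         = ε⋆
within⇒star (suc k) (inj₂ (c , r , w)) = r ◅ within⇒star k w

within? : ∀ {m} {R : Fin m → Fin m → Set} → Decidable R → ∀ k → Decidable (Within k R)
within? R? zero    a b = a ≟ b
within? R? (suc k) a b = a ≟ b ⊎-dec any? λ c → R? a c ×-dec within? R? k c b

module HeapCertificates {P : Set} (𝒞 : P → P → Set) where
  open HeapTheory 𝒞

  Comparable : ∀ {n} → RawHeap P n → Set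
  Comparable E = ∀ a b → 𝒞 (ε E a) (ε E b) → _≤_ E a b ⊎ _≤_ E b a

  GeneratedWithin : ℕ → ∀ {n} → RawHeap P n → Set
  GeneratedWithin k E = ∀ a b → _≤_ E a b → Within k (Gen E) a b

  SeparatedPairs : ∀ {n} → RawHeap P n → Set
  SeparatedPairs E =
    ∀ a b → E < a ∶ b → ε E a ≡ ε E b → ∃ λ y → E < a ∶ y × E < y ∶ b

  SeparatedTriples : ∀ {n} → RawHeap P n → Set
  SeparatedTriples E =
    ∀ a b c → E < a ∶ b → E < b ∶ c → ε E a ≡ ε E c →
    ∃ λ y → y ≢ b × E < a ∶ y × E < y ∶ c

  separated⇒P2 : ∀ {n} {E : RawHeap P n} → SeparatedPairs E → SeparatedTriples E → P2 E
  separated⇒P2 {E = E} pairs triples = noChain₂ , noChain₃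
    where
    noChain₂ : ∀ x → IsConvexChain E x → ¬ Balanced E x
    noChain₂ x (chain , convex) balanced
      with pairs (x zero) (x (suc zero)) (chain zero (suc zero) (s≤s z≤n)) balanced
    ... | y , x₀<y , y<x₁ with convex zero (suc zero) y x₀<y y<x₁
    ...   | zero     , y≡x₀ = proj₂ x₀<y (≡.sym y≡x₀)
    ...   | suc zero , y≡x₁ = proj₂ y<x₁ y≡x₁

    noChain₃ : ∀ x → IsConvexChain E x → ¬ Balanced E x
    noChain₃ x (chain , convex) balanced
      with triples (x zero) (x (suc zero)) (x (suc (suc zero)))
             (chain zero (suc zero) (s≤s z≤n)) (chain (suc zero) (suc (suc zero)) (s≤s (s≤s z≤n)))
             balanced
    ... | y , y≢x₁ , x₀<y , y<x₂ with convex zero (suc (suc zero)) y x₀<y y<x₂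
    ...   | zero           , y≡x₀ = proj₂ x₀<y (≡.sym y≡x₀)
    ...   | suc zero       , y≡x₁ = y≢x₁ y≡x₁
    ...   | suc (suc zero) , y≡x₂ = proj₂ y<x₂ y≡x₂

  NoNewMaxima : ∀ {m} → RawHeap P (suc m) → Fin (suc m) → Set
  NoNewMaxima E a = ∀ b →
    Maximal E (punchIn a b) ⊎ ∃ λ c → c ≢ b × Gen E (punchIn a b) (punchIn a c)

  NoNewMinima : ∀ {m} → RawHeap P (suc m) → Fin (suc m) → Set
  NoNewMinima E a = ∀ b →
    Minimal E (punchIn a b) ⊎ ∃ λ c → c ≢ b × Gen E (punchIn a c) (punchIn a b)

  noNewMaxima⇒¬Prec⁺ : ∀ {m} {E : RawHeap P (suc m)} {a} → NoNewMaxima E a → ¬ Prec⁺ E a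
  noNewMaxima⇒¬Prec⁺ none (_ , b , maximalAfter , ¬maximalBefore , _) with none b
  ... | inj₁ maximalBefore     = ¬maximalBefore maximalBefore
  ... | inj₂ (c , c≢b , b→c) = c≢b (maximalAfter c (b→c ◅ ε⋆))

  noNewMinima⇒¬Prec⁻ : ∀ {m} {E : RawHeap P (suc m)} {a} → NoNewMinima E a → ¬ Prec⁻ E a
  noNewMinima⇒¬Prec⁻ none (_ , b , minimalAfter , ¬minimalBefore , _) with none b
  ... | inj₁ minimalBefore     = ¬minimalBefore minimalBefore
  ... | inj₂ (c , c≢b , c→b) = c≢b (minimalAfter c (c→b ◅ ε⋆))

  Stuck : ∀ {m} → RawHeap P (suc m) → Set
  Stuck E = ¬ Trivial E × (∀ a → NoNewMaxima E a × NoNewMinima E a)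

  stuck⇒¬P1 : ∀ {m} {E : RawHeap P (suc m)} → Stuck E → ¬ P1 E
  stuck⇒¬P1         (nontrivial , _)    (inj₁ trivial)             = nontrivial trivial
  stuck⇒¬P1 {E = E} (_          , none) (inj₂ (a , inj₁ prec , _)) = noNewMaxima⇒¬Prec⁺ {E = E} (proj₁ (none a)) prec
  stuck⇒¬P1 {E = E} (_          , none) (inj₂ (a , inj₂ prec , _)) = noNewMinima⇒¬Prec⁻ {E = E} (proj₂ (none a)) prec

  module Decisions {m} (E : RawHeap P (suc m))
      (_≤?_ : Decidable (_≤_ E))
      (𝒞? : ∀ a b → Dec (𝒞 (ε E a) (ε E b)))
      (ε? : ∀ a b → Dec (ε E a ≡ ε E b)) where

    gen? : Decidable (Gen E)
    gen? a b = (a ≤? b) ×-dec 𝒞? a b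

    _<?ᴱ_ : ∀ a b → Dec (E < a ∶ b)
    a <?ᴱ b = (a ≤? b) ×-dec ¬? (a ≟ b)

    maximal? : ∀ a → Dec (Maximal E a)
    maximal? a = all? λ b → (a ≤? b) →-dec (b ≟ a)

    minimal? : ∀ a → Dec (Minimal E a)
    minimal? a = all? λ b → (b ≤? a) →-dec (b ≟ a)

    comparable? : Dec (Comparable E)
    comparable? = all? λ a → all? λ b → 𝒞? a b →-dec ((a ≤? b) ⊎-dec (b ≤? a))

    generatedWithin? : ∀ k → Dec (GeneratedWithin k E)
    generatedWithin? k = all? λ a → all? λ b → (a ≤? b) →-dec within? gen? k a b

    separatedPairs? : Dec (SeparatedPairs E)
    separatedPairs? = all? λ a → all? λ b →
      (a <?ᴱ b) →-dec ε? a b →-dec any? λ y → (a <?ᴱ y) ×-dec (y <?ᴱ b)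

    separatedTriples? : Dec (SeparatedTriples E)
    separatedTriples? = all? λ a → all? λ b → all? λ c →
      (a <?ᴱ b) →-dec (b <?ᴱ c) →-dec ε? a c →-dec
      any? λ y → ¬? (y ≟ b) ×-dec (a <?ᴱ y) ×-dec (y <?ᴱ c)

    noNewMaxima? : ∀ a → Dec (NoNewMaxima E a)
    noNewMaxima? a = all? λ b →
      maximal? (punchIn a b) ⊎-dec any? λ c → ¬? (c ≟ b) ×-dec gen? (punchIn a b) (punchIn a c)

    noNewMinima? : ∀ a → Dec (NoNewMinima E a)
    noNewMinima? a = all? λ b →
      minimal? (punchIn a b) ⊎-dec any? λ c → ¬? (c ≟ b) ×-dec gen? (punchIn a c) (punchIn a b)

    stuck? : Dec (Stuck E)
    stuck? = ¬? (all? λ a → all? λ b → (a ≤? b) →-dec (a ≟ b))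
      ×-dec all? λ a → noNewMaxima? a ×-dec noNewMinima? a

layered : ∀ {P : Set} {m} → (Fin m → P) → (Fin m → ℕ) → RawHeap P m
layered lab rank = record { ε = lab ; _≤_ = λ a b → a ≡ b ⊎ rank a < rank b }

module _ {P : Set} {m} (lab : Fin m → P) (rank : Fin m → ℕ) where

  layered-isPartialOrder : IsPartialOrder _≡_ (_≤_ (layered lab rank))
  layered-isPartialOrder = record
    { isPreorder = record
      { isEquivalence = isEquivalence
      ; reflexive     = inj₁
      ; trans         = trans
      }
    ; antisym = antisym
    }
    where
    trans : ∀ {a b c} → _≤_ (layered lab rank) a b → _≤_ (layered lab rank) b c →
            _≤_ (layered lab rank) a c
    trans (inj₁ refl) b≤c         = b≤c
    trans (inj₂ a<b)  (inj₁ refl) = inj₂ a<b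
    trans (inj₂ a<b)  (inj₂ b<c)  = inj₂ (<-trans a<b b<c)

    antisym : ∀ {a b} → _≤_ (layered lab rank) a b → _≤_ (layered lab rank) b a → a ≡ b
    antisym (inj₁ a≡b) _           = a≡b
    antisym (inj₂ _)   (inj₁ b≡a)  = ≡.sym b≡a
    antisym (inj₂ a<b) (inj₂ b<a)  = ⊥-elim (<-asym a<b b<a)

  layered-≤? : Decidable (_≤_ (layered lab rank))
  layered-≤? a b = (a ≟ b) ⊎-dec (rank a <? rank b)

module InducedCopy (Γ : Graph) (H : Graph)
    (_≟ᴴ_ : DecidableEquality (V H)) (adj? : Decidable (Adj H))
    (f : V H → V Γ) (f-injective : Injective _≡_ _≡_ f)
    (f-adj : ∀ u v → Adj H u v ⇔ Adj Γ (f u) (f v)) where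
  open HeapTheory (ConcRel Γ)
  open HeapCertificates (ConcRel Γ)

  concRel? : ∀ u v → Dec (ConcRel Γ (f u) (f v))
  concRel? u v = map′ (Sum.map (cong f) (Equivalence.to (f-adj u v)))
                      (Sum.map f-injective (Equivalence.from (f-adj u v)))
                      ((u ≟ᴴ v) ⊎-dec adj? u v)

  sameLabel? : ∀ u v → Dec (f u ≡ f v)
  sameLabel? u v = map′ (cong f) f-injective (u ≟ᴴ v)

  module _ {m} (lab : Fin (suc m) → V H) (rank : Fin (suc m) → ℕ) where
    private
      E : RawHeap (V Γ) (suc m)
      E = layered (f ∘ lab) rank

    open Decisions E (layered-≤? (f ∘ lab) rank)
      (λ a b → concRel? (lab a) (lab b)) (λ a b → sameLabel? (lab a) (lab b))

    counterexample? : Dec (Comparable E × GeneratedWithin 2 E ×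
                           SeparatedPairs E × SeparatedTriples E × Stuck E)
    counterexample? = comparable? ×-dec generatedWithin? 2 ×-dec
                      separatedPairs? ×-dec separatedTriples? ×-dec stuck?

    layered-¬PropertyR : True counterexample? → ¬ PropertyR Γ
    layered-¬PropertyR certified R with toWitness certified
    ... | comparable , generated , pairs , triples , stuck =
      stuck⇒¬P1 stuck (R E isHeap (separated⇒P2 pairs triples))
      where
      isHeap : IsHeap E
      isHeap = record
        { isPartialOrder = layered-isPartialOrder (f ∘ lab) rank
        ; comparable     = comparable
        ; generated      = λ a b a≤b → within⇒star 2 (generated a b a≤b)
        }

-- Paper's vertices 1,2,3,4 are # 0 … # 3; layers {1,3} < {2} < {4} < {1,3}.
¬PropertyR-K4minusEdge : ∀ Γ → HasInducedCopy Γ K4minusEdge → ¬ PropertyR Γ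
¬PropertyR-K4minusEdge Γ (f , f-injective , f-adj) =
  InducedCopy.layered-¬PropertyR Γ K4minusEdge _≟_ (λ u v → T? (k4e u v)) f f-injective f-adj
    (lookup (# 0 ∷ # 2 ∷ # 1 ∷ # 3 ∷ # 0 ∷ # 2 ∷ []))
    (lookup (0 ∷ 0 ∷ 1 ∷ 2 ∷ 3 ∷ 3 ∷ []))
    _  -- the certificate: counterexample? evaluates to yes

-- Paper's vertices 5,6,7,8 are # 0 … # 3; layers {5,7} < {6} < {8} < {7} < {6} < {5,8}.
¬PropertyR-Paw : ∀ Γ → HasInducedCopy Γ Paw → ¬ PropertyR Γ
¬PropertyR-Paw Γ (f , f-injective , f-adj) =
  InducedCopy.layered-¬PropertyR Γ Paw _≟_ (λ u v → T? (paw u v)) f f-injective f-adj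
    (lookup (# 0 ∷ # 2 ∷ # 1 ∷ # 3 ∷ # 2 ∷ # 1 ∷ # 0 ∷ # 3 ∷ []))
    (lookup (0 ∷ 0 ∷ 1 ∷ 2 ∷ 3 ∷ 4 ∷ 5 ∷ 5 ∷ []))
    _

lemma3p3p1 : (Γ : Graph) → PropertyR Γ →
    ¬ HasInducedCopy Γ K4minusEdge × ¬ HasInducedCopy Γ Paw
lemma3p3p1 Γ R = (λ copy → ¬PropertyR-K4minusEdge Γ copy R) , (λ copy → ¬PropertyR-Paw Γ copy R)
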